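{- Let $p \geq 17$ be an odd prime number, and let $A_1 = \{p-1\}$ and $A_2 = \left\{ \left\lfloor \frac{p}{2} \right\rfloor, p-2 \right\}$. Then for $a \in \{0,1,\ldots,p-1\}$ we have $h(a) = p$ if and only if $a \in A_1$, and $h(a) = (p+1)/2$ if and only if $a \in A_2$. Moreover, if $a \in \{0,1,2,\ldots,p-1\} \setminus (A_1 \cup A_2)$, then $h(a) \leq \frac{p}{2}$.
   Context: For an integer $x$ and an odd prime $p$, $x \bmod p$ denotes the least nonnegative integer congruent to $x$ modulo $p$. For $a \in \{0,1,\ldots,p-1\}$ the height is defined by $h(a) = \min\{ k + (ka \bmod p) : k = 1,2,\ldots,p-1\}$ (this is the height of the point $\langle 1, a \rangle$ of the projective line over $\mathbf{F}_p$). $\lfloor x \rfloor$ denotes the integer part of $x$. -}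

module Defs where

open import Data.Nat using (ℕ; zero; suc; _+_; _*_; _⊓_)
open import Data.Nat.DivMod using (_%_)

-- minUpTo f n = min { f k : 1 ≤ k ≤ n }   (for n ≥ 1; minUpTo f 0 = f 0 is never used)
minUpTo : (ℕ → ℕ) → ℕ → ℕ
minUpTo f zero = f zero
minUpTo f (suc zero) = f (suc zero)
minUpTo f (suc (suc n)) = f (suc (suc n)) ⊓ minUpTo f (suc n)

-- height of <1, a> over F_p:  h(a) = min { k + (k a mod p) : k = 1, ..., p-1 }
-- (p written as suc q so that the modulus is nonzero; k ranges over 1..q = p-1)
height : ℕ → ℕ → ℕ
height q a = minUpTo (λ k → k + (k * a) % suc q) q

module Submission where

-- Write p = 2m + 1, r = k a mod p and f k = k + r, so that h(a) is the minimum of f over 1 ≤ k ≤ 2m.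
-- Taking k = 1 gives h(a) ≤ a + 1, which settles a < m.  For a = p − 1, m, p − 2 every k satisfies
-- the congruence r + k ≡ 0, 2r + k ≡ 0, r + 2k ≡ 0 (mod p) respectively; as the left side is positive
-- it is at least p, which gives h = p, m + 1, m + 1.  The remaining a = p − b have 3 ≤ b ≤ m: dividing
-- p = K b + t gives K a ≡ t (mod p), hence h(a) ≤ K + t, and 2 (K + t) < p except when K = 2, b = 3,
-- which forces p ≤ 8.

open import Defs
open import Data.Nat using (ℕ; suc; _+_; _*_; _≤_; _<_; _∸_; _/_)
open import Data.Nat.Primality using (Prime)
open import Data.Product using (_×_)
open import Data.Sum using (_⊎_)
open import Relation.Binary.PropositionalEquality using (_≡_; _≢_)
open import Function.Bundles using (_⇔_)

open import Data.Nat using (zero; z≤n; s≤s; s≤s⁻¹; NonZero; >-nonZero)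
open import Data.Nat.Properties
open import Data.Nat.DivMod
  using (_%_; m≡m%n+[m/n]*n; m%n<n; m<n⇒m%n≡m; m≤n⇒m%n≡m; [m+kn]%n≡m%n; /-monoˡ-≤; m*n/n≡m)
open import Data.Nat.Divisibility using (_∣_; divides; ∣⇒≤; ∣m+n∣m⇒∣n; n∣m*n)
open import Data.Nat.Primality using (composite)
open import Data.Nat.Tactic.RingSolver using (solve-∀)
open import Data.Product using (_,_)
open import Data.Sum using (inj₁; inj₂)
open import Relation.Binary.Definitions using (tri<; tri≈; tri>)
open import Relation.Nullary using (contradiction; yes; no)
open import Relation.Binary.PropositionalEquality using (refl; sym; trans; cong; subst; module ≡-Reasoning)
open import Function.Bundles using (mk⇔)

minUpTo-suc-≤ : ∀ f n {k} → k ≤ suc (suc n) → (k ≤ suc n → minUpTo f (suc n) ≤ f k) →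
                minUpTo f (suc (suc n)) ≤ f k
minUpTo-suc-≤ f n k≤n+2 ih with m≤n⇒m<n∨m≡n k≤n+2
... | inj₁ k<n+2 = ≤-trans (m⊓n≤n _ _) (ih (s≤s⁻¹ k<n+2))
... | inj₂ refl  = m⊓n≤m _ _

minUpTo-≤ : ∀ f {n k} → 1 ≤ k → k ≤ n → minUpTo f n ≤ f k
minUpTo-≤ f {suc zero}    {suc zero}    _   _     = ≤-refl
minUpTo-≤ f {suc zero}    {suc (suc _)} _   (s≤s ())
minUpTo-≤ f {suc (suc n)}               1≤k k≤n+2 = minUpTo-suc-≤ f n k≤n+2 (minUpTo-≤ f 1≤k)

minUpTo-greatest : ∀ f {n c} → 1 ≤ n → (∀ k → 1 ≤ k → k ≤ n → c ≤ f k) → c ≤ minUpTo f n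
minUpTo-greatest f {suc zero}    _ c≤f = c≤f 1 ≤-refl ≤-refl
minUpTo-greatest f {suc (suc n)} _ c≤f =
  ⊓-glb (c≤f _ (s≤s z≤n) ≤-refl)
        (minUpTo-greatest f (s≤s z≤n) (λ k 1≤k k≤n+1 → c≤f k 1≤k (m≤n⇒m≤1+n k≤n+1)))

height-≤ : ∀ {q} a {k} → 1 ≤ k → k ≤ q → height q a ≤ k + (k * a) % suc q
height-≤ a = minUpTo-≤ (λ k → k + (k * a) % _)

height-greatest : ∀ {q a c} → 1 ≤ q → (∀ k → 1 ≤ k → k ≤ q → c ≤ k + (k * a) % suc q) →
                  c ≤ height q a
height-greatest = minUpTo-greatest _

height≤suc : ∀ {q a} → 1 ≤ q → a ≤ q → height q a ≤ suc a
height≤suc {q} {a} 1≤q a≤q = begin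
  height q a           ≤⟨ height-≤ a ≤-refl 1≤q ⟩
  1 + (1 * a) % suc q  ≡⟨ cong (λ x → 1 + x % suc q) (*-identityˡ a) ⟩
  1 + a % suc q        ≡⟨ cong suc (m≤n⇒m%n≡m a≤q) ⟩
  suc a                ∎
  where open ≤-Reasoning

n∣u*x+v⇒n≤u*[x%n]+v : ∀ {n} .{{_ : NonZero n}} u v x → n ∣ u * x + v → 0 < v →
                       n ≤ u * (x % n) + v
n∣u*x+v⇒n≤u*[x%n]+v {n} u v x n∣u*x+v 0<v =
  ∣⇒≤ {{>-nonZero (<-≤-trans 0<v (m≤n+m v _))}}
      (∣m+n∣m⇒∣n (subst (n ∣_) split n∣u*x+v) (n∣m*n (u * (x / n))))
  where
  distribute : ∀ u r Q n v → u * (r + Q * n) + v ≡ u * Q * n + (u * r + v)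
  distribute = solve-∀
  split : u * x + v ≡ u * (x / n) * n + (u * (x % n) + v)
  split = trans (cong (λ y → u * y + v) (m≡m%n+[m/n]*n x n)) (distribute u _ _ n v)

height-last : ∀ {q} → 1 ≤ q → height q q ≡ suc q
height-last {q} 1≤q = ≤-antisym (height≤suc 1≤q ≤-refl) (height-greatest 1≤q bound)
  where
  multiple : ∀ k q → 1 * (k * q) + k ≡ k * suc q
  multiple = solve-∀
  reorder : ∀ r k → 1 * r + k ≡ k + r
  reorder = solve-∀
  bound : ∀ k → 1 ≤ k → k ≤ q → suc q ≤ k + (k * q) % suc q
  bound k 1≤k _ = subst (suc q ≤_) (reorder _ k)
    (n∣u*x+v⇒n≤u*[x%n]+v 1 k (k * q) (divides k (multiple k q)) 1≤k)

height-half : ∀ {m} → 1 ≤ m → height (2 * m) m ≡ suc m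
height-half {m} 1≤m = ≤-antisym (height≤suc 1≤2m (m≤n*m m 2)) (height-greatest 1≤2m bound)
  where
  1≤2m : 1 ≤ 2 * m
  1≤2m = ≤-trans 1≤m (m≤n*m m 2)
  multiple : ∀ k m → 2 * (k * m) + k ≡ k * suc (2 * m)
  multiple = solve-∀
  shift : ∀ m → 2 * suc m ≡ suc (2 * m) + 1
  shift = solve-∀
  regroup : ∀ r k → (2 * r + k) + k ≡ 2 * (k + r)
  regroup = solve-∀
  bound : ∀ k → 1 ≤ k → k ≤ 2 * m → suc m ≤ k + (k * m) % suc (2 * m)
  bound k 1≤k _ = *-cancelˡ-≤ 2 (begin
    2 * suc m          ≡⟨ shift m ⟩
    suc (2 * m) + 1    ≤⟨ +-mono-≤ (n∣u*x+v⇒n≤u*[x%n]+v 2 k (k * m) n∣2km+k 1≤k) 1≤k ⟩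
    (2 * r + k) + k    ≡⟨ regroup r k ⟩
    2 * (k + r)        ∎)
    where
    open ≤-Reasoning
    r = (k * m) % suc (2 * m)
    n∣2km+k : suc (2 * m) ∣ 2 * (k * m) + k
    n∣2km+k = divides k (multiple k m)

height-penultimate : ∀ {m a} → 1 ≤ m → suc a ≡ 2 * m → height (2 * m) a ≡ suc m
height-penultimate {m@(suc m')} {a} _ suc[a]≡2m =
  ≤-antisym upper (height-greatest (≤-trans (s≤s z≤n) (m≤n*m m 2)) bound)
  where
  open ≤-Reasoning
  n = suc (2 * m)
  absorb : ∀ m a → m * a + m ≡ m * suc a
  absorb = solve-∀
  expand : ∀ m' → suc m' * (2 * suc m') ≡ (1 + m' * suc (2 * suc m')) + suc m'
  expand = solve-∀
  m*a≡1+m'*n : m * a ≡ 1 + m' * n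
  m*a≡1+m'*n = +-cancelʳ-≡ m _ _ (begin-equality
    m * a + m       ≡⟨ absorb m a ⟩
    m * suc a       ≡⟨ cong (m *_) suc[a]≡2m ⟩
    m * (2 * m)     ≡⟨ expand m' ⟩
    1 + m' * n + m  ∎)
  upper : height (2 * m) a ≤ suc m
  upper = begin
    height (2 * m) a      ≤⟨ height-≤ a (s≤s z≤n) (m≤n*m m 2) ⟩
    m + (m * a) % n       ≡⟨ cong (λ x → m + x % n) m*a≡1+m'*n ⟩
    m + (1 + m' * n) % n  ≡⟨ cong (m +_) ([m+kn]%n≡m%n 1 m' n) ⟩
    m + 1                 ≡⟨ +-comm m 1 ⟩
    suc m                 ∎
  multiple : ∀ k a → 1 * (k * a) + 2 * k ≡ k * suc (suc a)
  multiple = solve-∀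
  regroup : ∀ r k → 1 * r + 2 * k ≡ (k + r) + k
  regroup = solve-∀
  split : ∀ m → suc m + m ≡ suc (2 * m)
  split = solve-∀
  bound : ∀ k → 1 ≤ k → k ≤ 2 * m → suc m ≤ k + (k * a) % n
  bound k 1≤k _ with k ≤? m
  ... | no  k≰m = ≤-trans (≰⇒> k≰m) (m≤m+n k _)
  ... | yes k≤m = +-cancelʳ-≤ m _ _ (begin
    suc m + m                 ≡⟨ split m ⟩
    n                         ≤⟨ n∣u*x+v⇒n≤u*[x%n]+v 1 (2 * k) (k * a) n∣ka+2k 0<2k ⟩
    1 * ((k * a) % n) + 2 * k ≡⟨ regroup _ k ⟩
    (k + (k * a) % n) + k     ≤⟨ +-monoʳ-≤ _ k≤m ⟩
    (k + (k * a) % n) + m     ∎)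
    where
    0<2k : 0 < 2 * k
    0<2k = ≤-trans 1≤k (m≤n*m k 2)
    n∣ka+2k : n ∣ 1 * (k * a) + 2 * k
    n∣ka+2k = divides k (trans (multiple k a) (cong (λ x → k * suc x) suc[a]≡2m))

[1+K]*a≡t+K*n : ∀ {n a b K t} → a + b ≡ n → n ≡ t + suc K * b → suc K * a ≡ t + K * n
[1+K]*a≡t+K*n {n} {a} {b} {K} {t} a+b≡n n≡t+[1+K]b = +-cancelʳ-≡ (suc K * b) _ _ (begin
  suc K * a + suc K * b     ≡⟨ *-distribˡ-+ (suc K) a b ⟨
  suc K * (a + b)           ≡⟨ cong (suc K *_) a+b≡n ⟩
  n + K * n                 ≡⟨ cong (_+ K * n) n≡t+[1+K]b ⟩
  (t + suc K * b) + K * n   ≡⟨ +-exchange t (suc K * b) (K * n) ⟩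
  (t + K * n) + suc K * b   ∎)
  where
  open ≡-Reasoning
  +-exchange : ∀ t x y → (t + x) + y ≡ (t + y) + x
  +-exchange = solve-∀

height≤quotient+remainder : ∀ {q a b K t} → a + b ≡ suc q → suc q ≡ t + K * b → t < b → 1 ≤ K →
                            K ≤ q → height q a ≤ K + t
height≤quotient+remainder {q} {a} {b} {suc K} {t} a+b≡n n≡t+Kb t<b _ K≤q = begin
  height q a                        ≤⟨ height-≤ a (s≤s z≤n) K≤q ⟩
  suc K + (suc K * a) % suc q       ≡⟨ cong (λ x → suc K + x % suc q) Ka≡t+[K-1]n ⟩
  suc K + (t + K * suc q) % suc q   ≡⟨ cong (suc K +_) ([m+kn]%n≡m%n t K (suc q)) ⟩
  suc K + t % suc q                 ≡⟨ cong (suc K +_) (m<n⇒m%n≡m t<n) ⟩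
  suc K + t                         ∎
  where
  open ≤-Reasoning
  Ka≡t+[K-1]n : suc K * a ≡ t + K * suc q
  Ka≡t+[K-1]n = [1+K]*a≡t+K*n {K = K} {t} a+b≡n n≡t+Kb
  t<n : t < suc q
  t<n = <-≤-trans t<b (subst (b ≤_) a+b≡n (m≤n+m b a))

2*[2+i]+[3+j]≤[2+i]*[3+j] : ∀ i j → 1 ≤ i + j → 2 * (2 + i) + (3 + j) ≤ (2 + i) * (3 + j)
2*[2+i]+[3+j]≤[2+i]*[3+j] i j 1≤i+j = +-cancelʳ-≤ 1 _ _ (begin
  2 * (2 + i) + (3 + j) + 1                   ≤⟨ +-monoʳ-≤ _ (≤-trans 1≤i+j (m≤m+n (i + j) (i * j))) ⟩
  2 * (2 + i) + (3 + j) + (i + j + i * j)     ≡⟨ expand i j ⟩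
  (2 + i) * (3 + j) + 1                       ∎)
  where
  open ≤-Reasoning
  expand : ∀ i j → 2 * (2 + i) + (3 + j) + (i + j + i * j) ≡ (2 + i) * (3 + j) + 1
  expand = solve-∀

2*K+b≤K*b⇒2*[K+t]<t+K*b : ∀ {K b t} → t < b → 2 * K + b ≤ K * b → 2 * (K + t) < t + K * b
2*K+b≤K*b⇒2*[K+t]<t+K*b {K} {b} {t} t<b 2K+b≤Kb = begin
  suc (2 * (K + t))   ≡⟨ regroup K t ⟩
  t + (2 * K + suc t) ≤⟨ +-monoʳ-≤ t (+-monoʳ-≤ (2 * K) t<b) ⟩
  t + (2 * K + b)     ≤⟨ +-monoʳ-≤ t 2K+b≤Kb ⟩
  t + K * b           ∎
  where
  open ≤-Reasoning
  regroup : ∀ K t → suc (2 * (K + t)) ≡ t + (2 * K + suc t)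
  regroup = solve-∀

2*[K+t]<t+K*b : ∀ {K b t} → 2 ≤ K → 3 ≤ b → t < b → 9 ≤ t + K * b → 2 * (K + t) < t + K * b
2*[K+t]<t+K*b (s≤s (s≤s (z≤n {zero}))) (s≤s (s≤s (s≤s (z≤n {zero})))) t<3 9≤t+6 =
  contradiction 9≤t+6 (≤⇒≯ (+-monoˡ-≤ 6 (s≤s⁻¹ t<3)))
2*[K+t]<t+K*b (s≤s (s≤s (z≤n {zero}))) (s≤s (s≤s (s≤s (z≤n {suc j})))) t<b _ =
  2*K+b≤K*b⇒2*[K+t]<t+K*b t<b (2*[2+i]+[3+j]≤[2+i]*[3+j] 0 (suc j) (s≤s z≤n))
2*[K+t]<t+K*b (s≤s (s≤s (z≤n {suc i}))) (s≤s (s≤s (s≤s (z≤n {j})))) t<b _ =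
  2*K+b≤K*b⇒2*[K+t]<t+K*b t<b (2*[2+i]+[3+j]≤[2+i]*[3+j] (suc i) j (s≤s z≤n))

a+b≡n⇒a≡n∸b : ∀ {a b n} → a + b ≡ n → a ≡ n ∸ b
a+b≡n⇒a≡n∸b {a} {b} a+b≡n = trans (sym (m+n∸n≡m a b)) (cong (_∸ b) a+b≡n)

module OddModulus {m : ℕ} (4≤m : 4 ≤ m) where

  p : ℕ
  p = suc (2 * m)

  1≤m : 1 ≤ m
  1≤m = ≤-trans (s≤s z≤n) 4≤m

  m≤2m : m ≤ 2 * m
  m≤2m = m≤n*m m 2

  1≤2m : 1 ≤ 2 * m
  1≤2m = ≤-trans 1≤m m≤2m

  3≤b≤m⇒height≤m : ∀ {a b} → a + b ≡ p → 3 ≤ b → b ≤ m → height (2 * m) a ≤ m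
  3≤b≤m⇒height≤m {a} {b@(suc _)} a+b≡p 3≤b b≤m =
    ≤-trans (height≤quotient+remainder a+b≡p p≡t+Kb t<b (≤-trans (s≤s z≤n) 2≤K) K≤2m) K+t≤m
    where
    K = p / b
    t = p % b
    p≡t+Kb : p ≡ t + K * b
    p≡t+Kb = m≡m%n+[m/n]*n p b
    t<b : t < b
    t<b = m%n<n p b
    2≤K : 2 ≤ K
    2≤K = subst (_≤ K) (m*n/n≡m 2 b) (/-monoˡ-≤ b (≤-trans (*-monoʳ-≤ 2 b≤m) (n≤1+n _)))
    9≤t+Kb : 9 ≤ t + K * b
    9≤t+Kb = subst (9 ≤_) p≡t+Kb (s≤s (*-monoʳ-≤ 2 4≤m))
    K+t≤m : K + t ≤ m
    K+t≤m = *-cancelˡ-≤ 2 (s≤s⁻¹ (subst (2 * (K + t) <_) (sym p≡t+Kb)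
              (2*[K+t]<t+K*b 2≤K 3≤b t<b 9≤t+Kb)))
    K≤2m : K ≤ 2 * m
    K≤2m = ≤-trans (m≤m+n K t) (≤-trans K+t≤m m≤2m)

  data HeightCase : ℕ → Set where
    last        : HeightCase (2 * m)
    half        : HeightCase m
    penultimate : HeightCase (2 * m ∸ 1)
    low         : ∀ {a} → height (2 * m) a ≤ m → HeightCase a

  heightCase-above : ∀ {a} → m < a → a < p → ∀ b → a + b ≡ p → HeightCase a
  heightCase-above {a} _   a<p zero          a+0≡p =
    contradiction (trans (sym (+-identityʳ a)) a+0≡p) (<⇒≢ a<p)
  heightCase-above {a} _   _   1             a+1≡p = subst HeightCase (sym (a+b≡n⇒a≡n∸b a+1≡p)) last
  heightCase-above {a} _   _   2             a+2≡p = subst HeightCase (sym (a+b≡n⇒a≡n∸b a+2≡p)) penultimate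
  heightCase-above {a} m<a _   b@(suc (suc (suc _))) a+b≡p =
    low (3≤b≤m⇒height≤m a+b≡p (s≤s (s≤s (s≤s z≤n))) b≤m)
    where
    split : ∀ x → suc (2 * x) ≡ suc x + x
    split = solve-∀
    b≤m : b ≤ m
    b≤m = +-cancelˡ-≤ (suc m) b m (≤-trans (+-monoˡ-≤ b m<a) (≤-reflexive (trans a+b≡p (split m))))

  heightCase : ∀ {a} → a < p → HeightCase a
  heightCase {a} a<p with <-cmp a m
  ... | tri< a<m _ _  = low (≤-trans (height≤suc 1≤2m (≤-trans (<⇒≤ a<m) m≤2m)) a<m)
  ... | tri≈ _ refl _ = half
  ... | tri> _ _ m<a  = heightCase-above m<a a<p (p ∸ a) (m+[n∸m]≡n (<⇒≤ a<p))

  height[2m]≡p : height (2 * m) (2 * m) ≡ p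
  height[2m]≡p = height-last 1≤2m

  height[m]≡1+m : height (2 * m) m ≡ suc m
  height[m]≡1+m = height-half 1≤m

  height[2m∸1]≡1+m : height (2 * m) (2 * m ∸ 1) ≡ suc m
  height[2m∸1]≡1+m = height-penultimate 1≤m (trans (+-comm 1 _) (m∸n+n≡m 1≤2m))

  1+m≢p : suc m ≢ p
  1+m≢p = <⇒≢ (s≤s (m<m+n m (≤-trans 1≤m (m≤m+n m 0))))

  2*p≢p+1 : 2 * p ≢ p + 1
  2*p≢p+1 2p≡p+1 = <⇒≢ 1≤2m (sym (suc-injective (+-cancelˡ-≡ p _ _ (trans (sym (double p)) 2p≡p+1))))
    where
    double : ∀ x → 2 * x ≡ x + x
    double = solve-∀

  2*[1+m]≡p+1 : 2 * suc m ≡ p + 1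
  2*[1+m]≡p+1 = shift m
    where
    shift : ∀ x → 2 * suc x ≡ suc (2 * x) + 1
    shift = solve-∀

  height≡p⇔a∈A₁ : ∀ {a} → a < p → (height (2 * m) a ≡ p) ⇔ (a ≡ 2 * m)
  height≡p⇔a∈A₁ a<p = mk⇔ (onlyIf (heightCase a<p)) (λ { refl → height[2m]≡p })
    where
    onlyIf : ∀ {a} → HeightCase a → height (2 * m) a ≡ p → a ≡ 2 * m
    onlyIf last        _   = refl
    onlyIf half        h≡p = contradiction (trans (sym height[m]≡1+m) h≡p) 1+m≢p
    onlyIf penultimate h≡p = contradiction (trans (sym height[2m∸1]≡1+m) h≡p) 1+m≢p
    onlyIf (low h≤m)   h≡p = contradiction (subst (_≤ m) h≡p h≤m) (<⇒≱ (s≤s m≤2m))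

  2*height≡p+1⇔a∈A₂ : ∀ {a} → a < p →
                      (2 * height (2 * m) a ≡ p + 1) ⇔ ((a ≡ m) ⊎ (a ≡ 2 * m ∸ 1))
  2*height≡p+1⇔a∈A₂ a<p = mk⇔ (onlyIf (heightCase a<p)) if
    where
    onlyIf : ∀ {a} → HeightCase a → 2 * height (2 * m) a ≡ p + 1 → (a ≡ m) ⊎ (a ≡ 2 * m ∸ 1)
    onlyIf last        2h≡p+1 = contradiction (trans (cong (2 *_) (sym height[2m]≡p)) 2h≡p+1) 2*p≢p+1
    onlyIf half        _      = inj₁ refl
    onlyIf penultimate _      = inj₂ refl
    onlyIf (low h≤m)   2h≡p+1 =
      contradiction 2h≡p+1 (<⇒≢ (s≤s (≤-trans (*-monoʳ-≤ 2 h≤m) (m≤m+n _ 1))))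
    if : ∀ {a} → (a ≡ m) ⊎ (a ≡ 2 * m ∸ 1) → 2 * height (2 * m) a ≡ p + 1
    if (inj₁ refl) = trans (cong (2 *_) height[m]≡1+m) 2*[1+m]≡p+1
    if (inj₂ refl) = trans (cong (2 *_) height[2m∸1]≡1+m) 2*[1+m]≡p+1

  2*height≤p : ∀ {a} → a < p → a ≢ 2 * m → a ≢ m → a ≢ 2 * m ∸ 1 → 2 * height (2 * m) a ≤ p
  2*height≤p a<p = bound (heightCase a<p)
    where
    bound : ∀ {a} → HeightCase a → a ≢ 2 * m → a ≢ m → a ≢ 2 * m ∸ 1 → 2 * height (2 * m) a ≤ p
    bound last        a≢2m _   _      = contradiction refl a≢2m
    bound half        _    a≢m _      = contradiction refl a≢m
    bound penultimate _    _   a≢2m∸1 = contradiction refl a≢2m∸1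
    bound (low h≤m)   _    _   _      = ≤-trans (*-monoʳ-≤ 2 h≤m) (n≤1+n _)

prime≡1+2[p/2] : ∀ {p} → Prime p → 2 < p → p ≡ suc (2 * (p / 2))
prime≡1+2[p/2] {p} prime-p 2<p with p % 2 | m%n<n p 2 | m≡m%n+[m/n]*n p 2
... | zero        | _            | p≡[p/2]*2   =
  contradiction (composite 2<p (divides (p / 2) p≡[p/2]*2)) (Prime.notComposite prime-p)
... | suc zero    | _            | p≡1+[p/2]*2 = trans p≡1+[p/2]*2 (cong suc (*-comm (p / 2) 2))
... | suc (suc _) | s≤s (s≤s ()) | _

mainTheorem1 : (p : ℕ) → Prime p → 17 ≤ p → (a : ℕ) → a < p →
    ((height (p ∸ 1) a ≡ p) ⇔ (a ≡ p ∸ 1))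
    × ((2 * height (p ∸ 1) a ≡ p + 1) ⇔ ((a ≡ p / 2) ⊎ (a ≡ p ∸ 2)))
    × ((a ≢ p ∸ 1) → (a ≢ p / 2) → (a ≢ p ∸ 2) → 2 * height (p ∸ 1) a ≤ p)
-- Abstracting p / 2 as m lets p itself be replaced by 1 + 2m, turning p ∸ 1 and p ∸ 2 into 2m and 2m ∸ 1.
mainTheorem1 p prime-p 17≤p a a<p
  with p / 2 | prime≡1+2[p/2] prime-p (≤-trans (s≤s (s≤s (s≤s z≤n))) 17≤p)
... | m | refl = height≡p⇔a∈A₁ a<p , 2*height≡p+1⇔a∈A₂ a<p , 2*height≤p a<p
  where
  open OddModulus {m} (*-cancelˡ-≤ 2 (≤-trans (m≤n+m 8 8) (s≤s⁻¹ 17≤p)))
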